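{- Let $M$ be a binary matroid on a finite set $E$, $X\subseteq E$ with $e\in X$, and $M^e_X$ the es-splitting matroid. Let $A'\subseteq E\cup\{a,\gamma\}$ and $A=A'\setminus\{a,\gamma\}$. If $A'=A$ (i.e. $a,\gamma\notin A'$) and $cl(A)$ contains no OX-circuit of $M$, then $cl'(A')=cl(A)$.
   Context: Let $a,\gamma\notin E$ be two new elements. Let $A_M$ be a matrix over GF(2) representing $M$ (columns indexed by $E$). Form $A^e_X$ from $A_M$ by appending a new row $\delta_X$ whose entries are $1$ in the columns of elements of $X$ and $0$ elsewhere, and then appending two new columns: a column $a$ which is $0$ everywhere except for a $1$ in the new last row, and a column $\gamma$ which is the GF(2)-sum of the columns $a$ and $e$. The es-splitting matroid $M^e_X$ is the vector matroid of $A^e_X$, with ground set $E\cup\{a,\gamma\}$. $cl$ and $cl'$ denote the closure operators of $M$ and $M^e_X$. An OX-circuit of $M$ is a circuit of $M$ containing an odd number of elements of $X$; a set "contains an OX-circuit" if some OX-circuit of $M$ is a subset of it. -}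

module Defs where

open import Data.Bool using (Bool; true; false; _∧_; _xor_; not)
open import Data.Fin using (Fin; zero; suc)
open import Data.Nat using (ℕ; suc)
open import Data.Product using (Σ; _×_; ∃)
open import Relation.Binary.PropositionalEquality using (_≡_)
open import Relation.Nullary using (¬_)

-- GF(2) is modelled by Bool with _xor_ as addition and _∧_ as multiplication.
-- A matrix over GF(2) with m rows and columns indexed by Fin n.
Matrix : ℕ → ℕ → Set
Matrix m n = Fin m → Fin n → Bool

SubsetB : ℕ → Set
SubsetB n = Fin n → Bool

xorSum : ∀ {n} → (Fin n → Bool) → Bool
xorSum {ℕ.zero} f = false
xorSum {suc n} f = f zero xor xorSum (λ j → f (suc j))

colSum : ∀ {m n} → Matrix m n → SubsetB n → Fin m → Bool
colSum A S i = xorSum (λ j → S j ∧ A i j)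

_⊆_ : ∀ {n} → SubsetB n → SubsetB n → Set
S ⊆ T = ∀ j → S j ≡ true → T j ≡ true

Nonempty : ∀ {n} → SubsetB n → Set
Nonempty {n} S = Σ (Fin n) λ j → S j ≡ true

Dependent : ∀ {m n} → Matrix m n → SubsetB n → Set
Dependent A C = Σ (SubsetB _) λ S → S ⊆ C × Nonempty S × (∀ i → colSum A S i ≡ false)

Circuit : ∀ {m n} → Matrix m n → SubsetB n → Set
Circuit A C = Dependent A C × (∀ D → D ⊆ C → Dependent A D → C ⊆ D)

cl : ∀ {m n} → Matrix m n → SubsetB n → Fin n → Set
cl A S x = Σ (SubsetB _) λ T → T ⊆ S × (∀ i → colSum A T i ≡ A i x)

OXCircuit : ∀ {m n} → Matrix m n → SubsetB n → SubsetB n → Set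
OXCircuit A X C = Circuit A C × (xorSum (λ j → C j ∧ X j) ≡ true)

ContainsOXCircuit : ∀ {m n} → Matrix m n → SubsetB n → (Fin n → Set) → Set
ContainsOXCircuit A X P = Σ (SubsetB _) λ C → OXCircuit A X C × (∀ j → C j ≡ true → P j)

-- Ground set of M^e_X: Fin (suc (suc n)), where
--   zero        = a,
--   suc zero    = γ,
--   suc (suc j) = the old element j ∈ E.
-- Rows of A^e_X: zero = the new row δ_X, suc i = old row i.
aIdx : ∀ {n} → Fin (suc (suc n))
aIdx = zero

γIdx : ∀ {n} → Fin (suc (suc n))
γIdx = suc zero

old : ∀ {n} → Fin n → Fin (suc (suc n))
old j = suc (suc j)

withRow : ∀ {m n} → Matrix m n → SubsetB n → Matrix (suc m) n
withRow A X zero j = X j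
withRow A X (suc i) j = A i j

aCol : ∀ {m} → Fin (suc m) → Bool
aCol zero = true
aCol (suc i) = false

esMatrix : ∀ {m n} → Matrix m n → SubsetB n → Fin n → Matrix (suc m) (suc (suc n))
esMatrix A X e r zero = aCol r
esMatrix A X e r (suc zero) = aCol r xor withRow A X r e
esMatrix A X e r (suc (suc j)) = withRow A X r j

-- Every cycle of M (a set of columns summing to zero) contained in cl(A) meets X
-- evenly: a shortest odd one would be an OX-circuit, since a dependent proper subset
-- splits it into two shorter cycles, one of them odd. Hence every T ⊆ A spanning the
-- column of x in M has |T ∩ X| ≡ X(x) mod 2, as T + x is such a cycle. Row δ_X of
-- A^e_X asks for parity 1 to span a, 1 + X(e) = 0 to span γ and X(x) to span x ∈ E,
-- while its other rows are those of A_M.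
module Submission where

open import Defs
open import Algebra.Bundles using (CommutativeRing)
open import Data.Bool using (Bool; true; false; _∧_; _xor_)
open import Data.Bool.Properties
  using (xor-same; xor-identityʳ; ∧-distribʳ-xor; ∧-conicalˡ; xor-∧-commutativeRing)
open import Algebra.Properties.CommutativeSemigroup
  (CommutativeRing.+-commutativeSemigroup xor-∧-commutativeRing) using (interchange)
open import Data.Empty using (⊥-elim)
open import Data.Fin using (Fin; zero; suc)
open import Data.Fin.Subset using (∣_∣) renaming (_∈_ to _∈ᵥ_)
open import Data.Fin.Subset.Properties using (p⊂q⇒∣p∣<∣q∣)
open import Data.Nat using (ℕ; suc; _<_)
open import Data.Nat.Induction using (<-wellFounded)
open import Data.Product using (Σ; ∃; _×_; _,_)
open import Data.Vec using (tabulate)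
open import Data.Vec.Properties using (lookup∘tabulate; lookup⇒[]=; []=⇒lookup)
open import Function using (_on_; case_of_)
open import Induction.WellFounded using (Acc; acc)
open import Relation.Binary.Construct.On using () renaming (wellFounded to on-wellFounded)
open import Relation.Binary.PropositionalEquality
  using (_≡_; refl; sym; trans; cong; cong₂; subst; module ≡-Reasoning)
open import Relation.Nullary using (¬_)

xor≡false⇒≡ : ∀ x y → x xor y ≡ false → x ≡ y
xor≡false⇒≡ true  true  _ = refl
xor≡false⇒≡ false false _ = refl

xorSum-cong : ∀ {n} {f g : Fin n → Bool} → (∀ j → f j ≡ g j) → xorSum f ≡ xorSum g
xorSum-cong {ℕ.zero} f≗g = refl
xorSum-cong {suc n}  f≗g = cong₂ _xor_ (f≗g zero) (xorSum-cong (λ j → f≗g (suc j)))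

xorSum-xor : ∀ {n} (f g : Fin n → Bool) →
             xorSum (λ j → f j xor g j) ≡ xorSum f xor xorSum g
xorSum-xor {ℕ.zero} f g = refl
xorSum-xor {suc n}  f g = trans
  (cong ((f zero xor g zero) xor_) (xorSum-xor (λ j → f (suc j)) (λ j → g (suc j))))
  (interchange (f zero) (g zero) (xorSum (λ j → f (suc j))) (xorSum (λ j → g (suc j))))

xorSum-false : ∀ n → xorSum {n} (λ _ → false) ≡ false
xorSum-false ℕ.zero  = refl
xorSum-false (suc n) = xorSum-false n

xorSum≡true⇒∃ : ∀ {n} (f : Fin n → Bool) → xorSum f ≡ true → ∃ λ j → f j ≡ true
xorSum≡true⇒∃ {suc n} f sum≡true with f zero in f₀
... | true  = zero , f₀
... | false with xorSum≡true⇒∃ (λ j → f (suc j)) sum≡true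
...   | j , fj = suc j , fj

⁅_⁆ : ∀ {n} → Fin n → SubsetB n
⁅ zero  ⁆ zero    = true
⁅ zero  ⁆ (suc k) = false
⁅ suc j ⁆ zero    = false
⁅ suc j ⁆ (suc k) = ⁅ j ⁆ k

∈⁅⁆⇒≡ : ∀ {n} (j k : Fin n) → ⁅ j ⁆ k ≡ true → j ≡ k
∈⁅⁆⇒≡ zero    zero    _    = refl
∈⁅⁆⇒≡ (suc j) (suc k) j∈k = cong suc (∈⁅⁆⇒≡ j k j∈k)

xorSum-⁅⁆ : ∀ {n} (j : Fin n) (v : Fin n → Bool) → xorSum (λ k → ⁅ j ⁆ k ∧ v k) ≡ v j
xorSum-⁅⁆ {suc n} zero    v = trans (cong (v zero xor_) (xorSum-false n)) (xor-identityʳ (v zero))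
xorSum-⁅⁆ {suc n} (suc j) v = xorSum-⁅⁆ j (λ k → v (suc k))

_⊕_ : ∀ {n} → SubsetB n → SubsetB n → SubsetB n
(T ⊕ U) k = T k xor U k

⊆-false : ∀ {n} {S T : SubsetB n} → S ⊆ T → ∀ j → T j ≡ false → S j ≡ false
⊆-false {S = S} S⊆T j Tj with S j in Sj
... | false = refl
... | true with () ← trans (sym (S⊆T j Sj)) Tj

⊕-⊆ : ∀ {n} {T U : SubsetB n} → U ⊆ T → (T ⊕ U) ⊆ T
⊕-⊆ {T = T} {U} U⊆T k T⊕Uk with T k in Tk
... | true  = refl
... | false rewrite ⊆-false U⊆T k Tk with () ← T⊕Uk

⊕-same : ∀ {n} (T U : SubsetB n) k → T k ≡ U k → (T ⊕ U) k ≡ false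
⊕-same T U k Tk≡Uk = trans (cong (_xor U k) Tk≡Uk) (xor-same (U k))

size : ∀ {n} → SubsetB n → ℕ
size S = ∣ tabulate S ∣

size-< : ∀ {n} {S T : SubsetB n} → S ⊆ T → ∀ j → T j ≡ true → S j ≡ false → size S < size T
size-< {S = S} {T} S⊆T j Tj Sj = p⊂q⇒∣p∣<∣q∣ (S⊆ᵥT , j , ∈-tabulate T j Tj , j∉S)
  where
  ∈-tabulate : ∀ U k → U k ≡ true → k ∈ᵥ tabulate U
  ∈-tabulate U k Uk = lookup⇒[]= k (tabulate U) (trans (lookup∘tabulate U k) Uk)
  ∈-tabulate⁻ : ∀ U k → k ∈ᵥ tabulate U → U k ≡ true
  ∈-tabulate⁻ U k k∈U = trans (sym (lookup∘tabulate U k)) ([]=⇒lookup k∈U)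
  S⊆ᵥT : ∀ {k} → k ∈ᵥ tabulate S → k ∈ᵥ tabulate T
  S⊆ᵥT {k} k∈S = ∈-tabulate T k (S⊆T k (∈-tabulate⁻ S k k∈S))
  j∉S : ¬ j ∈ᵥ tabulate S
  j∉S j∈S = case trans (sym (∈-tabulate⁻ S j j∈S)) Sj of λ ()

Cycle : ∀ {m n} → Matrix m n → SubsetB n → Set
Cycle A T = ∀ i → colSum A T i ≡ false

parity : ∀ {n} → SubsetB n → SubsetB n → Bool
parity X T = xorSum (λ j → T j ∧ X j)

colSum-⊕ : ∀ {m n} (A : Matrix m n) (T U : SubsetB n) i →
           colSum A (T ⊕ U) i ≡ colSum A T i xor colSum A U i
colSum-⊕ A T U i = trans (xorSum-cong (λ k → ∧-distribʳ-xor (A i k) (T k) (U k)))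
                         (xorSum-xor (λ k → T k ∧ A i k) (λ k → U k ∧ A i k))

parity-⊕ : ∀ {n} (X T U : SubsetB n) → parity X (T ⊕ U) ≡ parity X T xor parity X U
parity-⊕ X T U = colSum-⊕ {m = 1} (λ _ → X) T U zero

cycle-⊕ : ∀ {m n} (A : Matrix m n) {T U : SubsetB n} → Cycle A T → Cycle A U → Cycle A (T ⊕ U)
cycle-⊕ A {T} {U} cycT cycU i = trans (colSum-⊕ A T U i) (cong₂ _xor_ (cycT i) (cycU i))

cycle-parity : ∀ {m n} (A : Matrix m n) (X : SubsetB n) {P : Fin n → Set} →
               ¬ ContainsOXCircuit A X P →
               (T : SubsetB n) → (∀ j → T j ≡ true → P j) → Cycle A T → parity X T ≡ false
cycle-parity {n = n} A X {P} noOX T = go T (on-wellFounded size <-wellFounded T)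
  where
  go : (T : SubsetB n) → Acc (_<_ on size) T →
       (∀ j → T j ≡ true → P j) → Cycle A T → parity X T ≡ false
  go T (acc shorter) T⊆P cycT with parity X T in odd
  ... | false = refl
  ... | true  = ⊥-elim (noOX (T , (circuit , odd) , T⊆P))
    where
    nonempty : Nonempty T
    nonempty with xorSum≡true⇒∃ (λ j → T j ∧ X j) odd
    ... | j , TjXj = j , ∧-conicalˡ (T j) (X j) TjXj

    minimal : ∀ D → D ⊆ T → Dependent A D → T ⊆ D
    minimal D D⊆T (S , S⊆D , (j₀ , Sj₀) , cycS) j Tj with D j in Dj
    ... | true  = refl
    ... | false = case trans (sym odd) even of λ ()
      where
      open ≡-Reasoning
      S⊆T : S ⊆ T
      S⊆T k Sk = D⊆T k (S⊆D k Sk)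
      evenS : parity X S ≡ false
      evenS = go S (shorter (size-< S⊆T j Tj (⊆-false S⊆D j Dj)))
                (λ k Sk → T⊆P k (S⊆T k Sk)) cycS
      evenT⊕S : parity X (T ⊕ S) ≡ false
      evenT⊕S = go (T ⊕ S)
        (shorter (size-< (⊕-⊆ S⊆T) j₀ (S⊆T j₀ Sj₀) (⊕-same T S j₀ (trans (S⊆T j₀ Sj₀) (sym Sj₀)))))
        (λ k T⊕Sk → T⊆P k (⊕-⊆ S⊆T k T⊕Sk)) (cycle-⊕ A cycT cycS)
      even : parity X T ≡ false
      even = begin
        parity X T                   ≡⟨ sym (xor-identityʳ _) ⟩
        parity X T xor false         ≡⟨ cong (parity X T xor_) (sym evenS) ⟩
        parity X T xor parity X S    ≡⟨ sym (parity-⊕ X T S) ⟩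
        parity X (T ⊕ S)             ≡⟨ evenT⊕S ⟩
        false                        ∎

    circuit : Circuit A T
    circuit = (T , (λ _ Tj → Tj) , nonempty , cycT) , minimal

∈⇒∈cl : ∀ {m n} (A : Matrix m n) {S : SubsetB n} j → S j ≡ true → cl A S j
∈⇒∈cl A {S} j Sj = ⁅ j ⁆ , ⁅j⁆⊆S , λ i → xorSum-⁅⁆ j (A i)
  where
  ⁅j⁆⊆S : ⁅ j ⁆ ⊆ S
  ⁅j⁆⊆S k j∈k = subst (λ l → S l ≡ true) (∈⁅⁆⇒≡ j k j∈k) Sj

span-parity : ∀ {m n} (A : Matrix m n) (X S : SubsetB n) →
              ¬ ContainsOXCircuit A X (cl A S) →
              ∀ j (T : SubsetB n) → T ⊆ S → (∀ i → colSum A T i ≡ A i j) → parity X T ≡ X j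
span-parity A X S noOX j T T⊆S T-spans-j = xor≡false⇒≡ (parity X T) (X j) (begin
    parity X T xor X j             ≡⟨ cong (parity X T xor_) (sym (xorSum-⁅⁆ j X)) ⟩
    parity X T xor parity X ⁅ j ⁆  ≡⟨ sym (parity-⊕ X T ⁅ j ⁆) ⟩
    parity X (T ⊕ ⁅ j ⁆)           ≡⟨ cycle-parity A X noOX (T ⊕ ⁅ j ⁆) T+j⊆clS cycle ⟩
    false                          ∎)
  where
  open ≡-Reasoning
  cycle : Cycle A (T ⊕ ⁅ j ⁆)
  cycle i = begin
    colSum A (T ⊕ ⁅ j ⁆) i            ≡⟨ colSum-⊕ A T ⁅ j ⁆ i ⟩
    colSum A T i xor colSum A ⁅ j ⁆ i ≡⟨ cong₂ _xor_ (T-spans-j i) (xorSum-⁅⁆ j (A i)) ⟩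
    A i j xor A i j                   ≡⟨ xor-same (A i j) ⟩
    false                             ∎
  T+j⊆clS : ∀ k → (T ⊕ ⁅ j ⁆) k ≡ true → cl A S k
  T+j⊆clS k T+jk with T k in Tk
  ... | true  = ∈⇒∈cl A k (T⊆S k Tk)
  ... | false = subst (cl A S) (∈⁅⁆⇒≡ j k T+jk) (T , T⊆S , T-spans-j)

lift : ∀ {n} → SubsetB n → SubsetB (suc (suc n))
lift T zero          = false
lift T (suc zero)    = false
lift T (suc (suc k)) = T k

lift-⊆ : ∀ {n} {T : SubsetB n} {U : SubsetB (suc (suc n))} →
         T ⊆ (λ k → U (old k)) → lift T ⊆ U
lift-⊆ T⊆U (suc (suc k)) Tk = T⊆U k Tk

colSum-esMatrix : ∀ {m n} (A : Matrix m n) (X : SubsetB n) (e : Fin n) (T : SubsetB (suc (suc n))) →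
                  T aIdx ≡ false → T γIdx ≡ false →
                  ∀ r → colSum (esMatrix A X e) T r ≡ colSum (withRow A X) (λ k → T (old k)) r
colSum-esMatrix A X e T Ta Tγ r rewrite Ta | Tγ = refl

cl-esMatrix-restrict : ∀ {m n} (A : Matrix m n) (X : SubsetB n) (e : Fin n) (A' : SubsetB (suc (suc n))) →
  A' aIdx ≡ false → A' γIdx ≡ false → ∀ x → cl (esMatrix A X e) A' x →
  Σ (SubsetB n) λ T → T ⊆ (λ k → A' (old k)) × (∀ r → colSum (withRow A X) T r ≡ esMatrix A X e r x)
cl-esMatrix-restrict A X e A' A'a A'γ x (T , T⊆A' , sums) =
  (λ k → T (old k)) , (λ k → T⊆A' (old k)) ,
  λ r → trans (sym (colSum-esMatrix A X e T (⊆-false T⊆A' aIdx A'a) (⊆-false T⊆A' γIdx A'γ) r)) (sums r)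

lemma3p4 : (m n : ℕ) (AM : Matrix m n) (X : SubsetB n) (e : Fin n) → X e ≡ true →
    (A' : SubsetB (suc (suc n))) → A' aIdx ≡ false → A' γIdx ≡ false →
    ¬ ContainsOXCircuit AM X (cl AM (λ j → A' (old j))) →
    ¬ cl (esMatrix AM X e) A' aIdx × ¬ cl (esMatrix AM X e) A' γIdx ×
    ((j : Fin n) → (cl (esMatrix AM X e) A' (old j) → cl AM (λ k → A' (old k)) j)
                 × (cl AM (λ k → A' (old k)) j → cl (esMatrix AM X e) A' (old j)))
lemma3p4 m n AM X e Xe A' A'a A'γ noOX = a∉cl' , γ∉cl' , λ j → cl'⇒cl j , cl⇒cl' j
  where
  S : SubsetB n
  S k = A' (old k)
  restrict : ∀ x → cl (esMatrix AM X e) A' x →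
    Σ (SubsetB n) λ T → T ⊆ S × (∀ r → colSum (withRow AM X) T r ≡ esMatrix AM X e r x)
  restrict = cl-esMatrix-restrict AM X e A' A'a A'γ

  a∉cl' : ¬ cl (esMatrix AM X e) A' aIdx
  a∉cl' a∈cl' with restrict aIdx a∈cl'
  ... | T , T⊆S , sums = case trans (sym (sums zero)) even of λ ()
    where
    even : parity X T ≡ false
    even = cycle-parity AM X noOX T (λ k Tk → ∈⇒∈cl AM k (T⊆S k Tk)) (λ i → sums (suc i))

  γ∉cl' : ¬ cl (esMatrix AM X e) A' γIdx
  γ∉cl' γ∈cl' with restrict γIdx γ∈cl'
  ... | T , T⊆S , sums = case subst (λ b → b ≡ true xor b) Xe (trans (sym spans) (sums zero)) of λ ()
    where
    spans : parity X T ≡ X e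
    spans = span-parity AM X S noOX e T T⊆S (λ i → sums (suc i))

  cl'⇒cl : ∀ j → cl (esMatrix AM X e) A' (old j) → cl AM S j
  cl'⇒cl j j∈cl' with restrict (old j) j∈cl'
  ... | T , T⊆S , sums = T , T⊆S , λ i → sums (suc i)

  cl⇒cl' : ∀ j → cl AM S j → cl (esMatrix AM X e) A' (old j)
  cl⇒cl' j (T , T⊆S , sums) = lift T , lift-⊆ T⊆S , λ
    { zero    → span-parity AM X S noOX j T T⊆S sums
    ; (suc i) → sums i }
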